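{- Let $v\equiv 3\pmod 4$ and let $\alpha,\beta$ be nonzero elements of $\mathbb{Z}_v$. If there exists an APS$(v,\alpha,\beta)$, then $$2\alpha^2-\beta^2\equiv\begin{cases}\frac{v}{3}\pmod v, & \text{if } v\equiv 3\pmod{12},\\ 0\pmod v, & \text{if } v\equiv 7,11\pmod{12}.\end{cases}$$
   Context: APS$(v,\alpha,\beta)$ ($v\equiv3\pmod4$, $\alpha,\beta$ nonzero in $\mathbb{Z}_v$): a set $\mathcal S$ of $(v-3)/4$ unordered pairs $\{x,y\}$ from $\mathbb{Z}_v$ with $\bigcup_{\{x,y\}\in\mathcal S}\pm\{x,y\}=\mathbb{Z}_v\setminus\{0,\pm\alpha\}$ and $\bigcup_{\{x,y\}\in\mathcal S}\pm\{x-y,x+y\}=\mathbb{Z}_v\setminus\{0,\pm\beta\}$. -}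

module Defs where

open import Data.Nat using (ℕ; _+_; _*_; _∸_; NonZero)
open import Data.Nat.DivMod using (_mod_; _/_)
open import Data.Fin using (Fin; toℕ)
open import Data.Product using (_×_; _,_)
open import Data.Sum using (_⊎_)
open import Data.List using (List; length)
open import Data.List.Relation.Unary.Any using (Any)
open import Relation.Binary.PropositionalEquality using (_≡_)
open import Relation.Nullary using (¬_)

module ZMod (v : ℕ) .{{_ : NonZero v}} where

  ZV : Set
  ZV = Fin v

  [_] : ℕ → ZV
  [ n ] = n mod v

  0v : ZV
  0v = [ 0 ]

  _+v_ : ZV → ZV → ZV
  x +v y = [ toℕ x + toℕ y ]

  -v_ : ZV → ZV
  -v x = [ v ∸ toℕ x ]

  _-v_ : ZV → ZV → ZV
  x -v y = x +v (-v y)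

  _*v_ : ZV → ZV → ZV
  x *v y = [ toℕ x * toℕ y ]

  InPM : ZV → ZV × ZV → Set
  InPM z (x , y) = z ≡ x ⊎ z ≡ -v x ⊎ z ≡ y ⊎ z ≡ -v y

  InPMDiffSum : ZV → ZV × ZV → Set
  InPMDiffSum z (x , y) = InPM z (x -v y , x +v y)

  -- APS(v, α, β): a family S of (v-3)/4 (unordered) pairs {x,y}, given as a
  -- list of representatives (x , y), such that
  --   ⋃ ±{x,y}       = ℤ_v ∖ {0, ±α}
  --   ⋃ ±{x-y, x+y}  = ℤ_v ∖ {0, ±β}
  record IsAPS (α β : ZV) (S : List (ZV × ZV)) : Set where
    field
      size   : length S ≡ (v ∸ 3) / 4
      cover₁ : ∀ z → Any (InPM z) S → ¬ (z ≡ 0v ⊎ z ≡ α ⊎ z ≡ -v α)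
      cover₁' : ∀ z → ¬ (z ≡ 0v ⊎ z ≡ α ⊎ z ≡ -v α) → Any (InPM z) S
      cover₂ : ∀ z → Any (InPMDiffSum z) S → ¬ (z ≡ 0v ⊎ z ≡ β ⊎ z ≡ -v β)
      cover₂' : ∀ z → ¬ (z ≡ 0v ⊎ z ≡ β ⊎ z ≡ -v β) → Any (InPMDiffSum z) S

-- Sum the squares of all residues mod v in two ways. Since (x-y)² + (x+y)² = 2(x² + y²), writing
-- A = Σ (x² + y²) and Q = Σ_{z ∈ ℤ_v} z² gives Q ≡ 2A + 2α² and
-- Q ≡ 4A + 2β², hence 2(2α² - β²) ≡ Q. Finally Q = (v-1)v(2v-1)/6, which
-- is 0 mod v when 3 ∤ v and 2v/3 mod v when v ≡ 3 (mod 12); v is odd, so 2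
-- can be cancelled.
module Submission where

open import Defs
open import Data.Nat using (ℕ; NonZero; _%_; _/_)
open import Data.Fin using (Fin)
open import Data.Product using (_×_; ∃)
open import Data.Sum using (_⊎_)
open import Data.List using (List)
open import Relation.Binary.PropositionalEquality using (_≡_; _≢_)

open import Function using (_∘_; id)
open import Level using (0ℓ)
open import Data.Empty using (⊥-elim)
open import Data.Product using (_,_)
open import Data.Sum using (inj₁; inj₂)
open import Data.Nat using (zero; suc; _+_; _*_; _∸_; _≤_)
open import Data.Nat.Properties
  using (+-identityʳ; +-assoc; +-comm; *-distribˡ-+; *-cancelˡ-≡; ≤-pred; ≤-trans; ≤-reflexive; <⇒≤; m+[n∸m]≡n; m∸n+n≡m)
open import Data.Nat.DivMod
  using (%-distribˡ-+; %-distribˡ-*; [m+kn]%n≡m%n; m%n%n≡m%n; m%n<n; m<n⇒m%n≡m; m≡m%n+[m/n]*n; m*n/n≡m; m∣n⇒o%n%m≡o%m)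
open import Data.Nat.Divisibility using (divides)
open import Data.Nat.Tactic.RingSolver using (solve-∀)
open import Data.Nat.ListAction using (sum)
open import Data.Nat.ListAction.Properties using (sum-++; sum-↭)
open import Data.Fin using (toℕ; _≟_)
open import Data.Fin.Properties using (toℕ-fromℕ<; toℕ<n; toℕ-injective)
open import Data.List using ([]; _∷_; _++_; _∷ʳ_; length; map; concatMap; tabulate; applyUpTo; upTo; allFin)
open import Data.List.Properties using (length-map; length-++; length-++-sucʳ; length-tabulate; map-++; map-tabulate; upTo-∷ʳ; map-upTo)
open import Data.List.Membership.Propositional using (_∈_)
open import Data.List.Membership.Propositional.Properties using (∈-∃++; ∈-++⁻; ∈-++⁺ˡ; ∈-++⁺ʳ; ∈-concatMap⁺)
open import Data.List.Relation.Binary.Subset.Propositional using (_⊆_)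
open import Data.List.Relation.Binary.Permutation.Propositional using (_↭_; prep; ↭-trans; ↭-refl)
import Data.List.Relation.Binary.Permutation.Propositional.Properties as ↭
open import Data.List.Relation.Unary.Any using (Any; here; there)
import Data.List.Relation.Unary.Any as Any
import Data.List.Relation.Unary.Any.Properties as Any
import Data.List.Relation.Unary.All as All
open import Data.List.Relation.Unary.AllPairs using (_∷_)
open import Data.List.Relation.Unary.Unique.Propositional using (Unique)
open import Data.List.Relation.Unary.Unique.Propositional.Properties using (allFin⁺)
open import Relation.Binary.Bundles using (Setoid)
import Relation.Binary.Construct.On as On
import Relation.Binary.Reasoning.Setoid as SetoidReasoning
open import Relation.Binary.PropositionalEquality using (refl; sym; trans; cong; cong₂; subst; module ≡-Reasoning)
import Relation.Binary.PropositionalEquality as ≡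
open import Relation.Nullary using (¬_; yes; no)
open import Relation.Nullary.Decidable using (_⊎-dec_)

⊆∧length≤⇒↭ : {A : Set} {xs ys : List A} → Unique ys → ys ⊆ xs → length xs ≤ length ys → xs ↭ ys
⊆∧length≤⇒↭ {xs = []} {ys = []} _ _ _ = ↭-refl
⊆∧length≤⇒↭ {xs = _ ∷ _} {ys = []} _ _ ()
⊆∧length≤⇒↭ {ys = y ∷ ys} (y∉ys ∷ unique) ys⊆xs |xs|≤ with ∈-∃++ (ys⊆xs (here refl))
... | as , bs , refl = ↭-trans (↭.shift y as bs) (prep y (⊆∧length≤⇒↭ unique ys⊆as++bs |as++bs|≤))
  where
  ys⊆as++bs : ys ⊆ as ++ bs
  ys⊆as++bs {z} z∈ys with ∈-++⁻ as (ys⊆xs (there z∈ys))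
  ... | inj₁ z∈as = ∈-++⁺ˡ z∈as
  ... | inj₂ (here refl) = ⊥-elim (All.lookup y∉ys z∈ys refl)
  ... | inj₂ (there z∈bs) = ∈-++⁺ʳ as z∈bs
  |as++bs|≤ : length (as ++ bs) ≤ length ys
  |as++bs|≤ = ≤-pred (≤-trans (≤-reflexive (sym (length-++-sucʳ as y bs))) |xs|≤)

[n∸3]/4*4+3≡n : ∀ {n} → n % 4 ≡ 3 → (n ∸ 3) / 4 * 4 + 3 ≡ n
[n∸3]/4*4+3≡n {n} n%4≡3 = begin
  (n ∸ 3) / 4 * 4 + 3          ≡⟨ cong (λ m → (m ∸ 3) / 4 * 4 + 3) n≡3+4j ⟩
  j * 4 / 4 * 4 + 3            ≡⟨ cong (λ m → m * 4 + 3) (m*n/n≡m j 4) ⟩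
  j * 4 + 3                    ≡⟨ +-comm (j * 4) 3 ⟩
  3 + j * 4                    ≡⟨ n≡3+4j ⟨
  n                            ∎
  where
  open ≡-Reasoning
  j = n / 4
  n≡3+4j : n ≡ 3 + j * 4
  n≡3+4j = trans (m≡m%n+[m/n]*n n 4) (cong (_+ j * 4) n%4≡3)

infixl 8 _²
_² : ℕ → ℕ
n ² = n * n

squareSum : ℕ → ℕ
squareSum n = sum (map _² (upTo n))

squareSum-suc : ∀ n → squareSum (suc n) ≡ squareSum n + n ²
squareSum-suc n = begin
  sum (map _² (upTo (suc n)))             ≡⟨ cong (sum ∘ map _²) (upTo-∷ʳ n) ⟨
  sum (map _² (upTo n ∷ʳ n))              ≡⟨ cong sum (map-++ _² (upTo n) (n ∷ [])) ⟩
  sum (map _² (upTo n) ++ n ² ∷ [])       ≡⟨ sum-++ (map _² (upTo n)) (n ² ∷ []) ⟩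
  squareSum n + (n ² + 0)                 ≡⟨ cong (squareSum n +_) (+-identityʳ (n ²)) ⟩
  squareSum n + n ²                       ∎
  where open ≡-Reasoning

6*squareSum : ∀ n → 6 * squareSum (suc n) ≡ n * suc n * (1 + 2 * n)
6*squareSum zero = refl
6*squareSum (suc n) = begin
  6 * squareSum (2 + n)                   ≡⟨ cong (6 *_) (squareSum-suc (suc n)) ⟩
  6 * (squareSum (suc n) + suc n ²)       ≡⟨ *-distribˡ-+ 6 (squareSum (suc n)) (suc n ²) ⟩
  6 * squareSum (suc n) + 6 * suc n ²     ≡⟨ cong (_+ 6 * suc n ²) (6*squareSum n) ⟩
  n * suc n * (1 + 2 * n) + 6 * suc n ²   ≡⟨ identity n ⟩
  suc n * (2 + n) * (1 + 2 * suc n)       ∎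
  where
  open ≡-Reasoning
  identity : ∀ n → n * suc n * (1 + 2 * n) + 6 * (suc n * suc n) ≡ suc n * (2 + n) * (1 + 2 * suc n)
  identity = solve-∀

squareSum-3+12k : ∀ {n} k → n ≡ 3 + k * 12 → squareSum n ≡ 2 * (1 + k * 4) + (1 + 18 * k + 48 * k * k) * n
squareSum-3+12k k refl = *-cancelˡ-≡ _ _ 6 (trans (6*squareSum (2 + k * 12)) (identity k))
  where
  identity : ∀ k → (2 + k * 12) * (3 + k * 12) * (1 + 2 * (2 + k * 12))
                 ≡ 6 * (2 * (1 + k * 4) + (1 + 18 * k + 48 * k * k) * (3 + k * 12))
  identity = solve-∀

squareSum-7+12k : ∀ {n} k → n ≡ 7 + k * 12 → squareSum n ≡ (1 + 2 * k) * (13 + 24 * k) * n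
squareSum-7+12k k refl = *-cancelˡ-≡ _ _ 6 (trans (6*squareSum (6 + k * 12)) (identity k))
  where
  identity : ∀ k → (6 + k * 12) * (7 + k * 12) * (1 + 2 * (6 + k * 12))
                 ≡ 6 * ((1 + 2 * k) * (13 + 24 * k) * (7 + k * 12))
  identity = solve-∀

squareSum-11+12k : ∀ {n} k → n ≡ 11 + k * 12 → squareSum n ≡ (5 + 6 * k) * (7 + 8 * k) * n
squareSum-11+12k k refl = *-cancelˡ-≡ _ _ 6 (trans (6*squareSum (10 + k * 12)) (identity k))
  where
  identity : ∀ k → (10 + k * 12) * (11 + k * 12) * (1 + 2 * (10 + k * 12))
                 ≡ 6 * ((5 + 6 * k) * (7 + 8 * k) * (11 + k * 12))
  identity = solve-∀

tabulate-∘toℕ : {A : Set} (n : ℕ) (f : ℕ → A) → tabulate (f ∘ toℕ {n}) ≡ applyUpTo f n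
tabulate-∘toℕ zero f = refl
tabulate-∘toℕ (suc n) f = cong (f 0 ∷_) (tabulate-∘toℕ n (f ∘ suc))

map-∘toℕ-allFin : {A : Set} (n : ℕ) (f : ℕ → A) → map (f ∘ toℕ) (allFin n) ≡ map f (upTo n)
map-∘toℕ-allFin n f = trans (map-tabulate id (f ∘ toℕ)) (trans (tabulate-∘toℕ n f) (sym (map-upTo f n)))

module Congruence (v : ℕ) .{{_ : NonZero v}} where

  infix 4 _≈_
  _≈_ : ℕ → ℕ → Set
  m ≈ n = m % v ≡ n % v

  ≈-setoid : Setoid 0ℓ 0ℓ
  ≈-setoid = On.setoid (≡.setoid ℕ) (_% v)

  module ≈-Reasoning = SetoidReasoning ≈-setoid

  m+kv≈m : ∀ m k → m + k * v ≈ m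
  m+kv≈m m k = [m+kn]%n≡m%n m k v

  v≈0 : v ≈ 0
  v≈0 = trans (cong (_% v) (sym (+-identityʳ v))) (m+kv≈m 0 1)

  +-cong : ∀ {m n p q} → m ≈ n → p ≈ q → m + p ≈ n + q
  +-cong {m} {n} {p} {q} m≈n p≈q =
    trans (%-distribˡ-+ m p v) (trans (cong₂ (λ a b → (a + b) % v) m≈n p≈q) (sym (%-distribˡ-+ n q v)))

  *-cong : ∀ {m n p q} → m ≈ n → p ≈ q → m * p ≈ n * q
  *-cong {m} {n} {p} {q} m≈n p≈q =
    trans (%-distribˡ-* m p v) (trans (cong₂ (λ a b → (a * b) % v) m≈n p≈q) (sym (%-distribˡ-* n q v)))

  m+[v∸m]≈0 : ∀ {m} → m ≤ v → m + (v ∸ m) ≈ 0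
  m+[v∸m]≈0 m≤v = trans (cong (_% v) (m+[n∸m]≡n m≤v)) v≈0

  +-cancelʳ : ∀ {m n} p → m + p ≈ n + p → m ≈ n
  +-cancelʳ {m} {n} p m+p≈n+p = begin
    m                ≡⟨ +-identityʳ m ⟨
    m + 0            ≈⟨ +-cong refl p+p′≈0 ⟨
    m + (p + p′)     ≡⟨ +-assoc m p p′ ⟨
    m + p + p′       ≈⟨ +-cong m+p≈n+p refl ⟩
    n + p + p′       ≡⟨ +-assoc n p p′ ⟩
    n + (p + p′)     ≈⟨ +-cong refl p+p′≈0 ⟩
    n + 0            ≡⟨ +-identityʳ n ⟩
    n                ∎
    where
    open ≈-Reasoning
    p′ = v ∸ p % v
    p+p′≈0 : p + p′ ≈ 0
    p+p′≈0 = trans (+-cong (sym (m%n%n≡m%n p v)) refl) (m+[v∸m]≈0 (<⇒≤ (m%n<n p v)))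

  -- 1 + v / 2 is the inverse of 2 modulo an odd v.
  *-cancelˡ-2 : v % 2 ≡ 1 → ∀ {m n} → 2 * m ≈ 2 * n → m ≈ n
  *-cancelˡ-2 v-odd {m} {n} 2m≈2n = begin
    m                    ≈⟨ m+kv≈m m m ⟨
    m + m * v            ≡⟨ m+mv≡[1+h]*2m m ⟩
    (1 + h) * (2 * m)    ≈⟨ *-cong {1 + h} refl 2m≈2n ⟩
    (1 + h) * (2 * n)    ≡⟨ m+mv≡[1+h]*2m n ⟨
    n + n * v            ≈⟨ m+kv≈m n n ⟩
    n                    ∎
    where
    open ≈-Reasoning
    h = v / 2
    v≡1+2h : v ≡ 1 + h * 2
    v≡1+2h = trans (m≡m%n+[m/n]*n v 2) (cong (_+ h * 2) v-odd)
    identity : ∀ h m → m + m * (1 + h * 2) ≡ (1 + h) * (2 * m)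
    identity = solve-∀
    m+mv≡[1+h]*2m : ∀ m → m + m * v ≡ (1 + h) * (2 * m)
    m+mv≡[1+h]*2m m = subst (λ u → m + m * u ≡ (1 + h) * (2 * m)) (sym v≡1+2h) (identity h m)

  [v∸m]²≈m² : ∀ {m} → m ≤ v → (v ∸ m) ² ≈ m ²
  [v∸m]²≈m² {m} m≤v = begin
    w ²                  ≈⟨ m+kv≈m (w ²) (2 * m) ⟨
    w ² + 2 * m * v      ≡⟨ subst (λ u → w ² + 2 * m * u ≡ m ² + u * u) (m∸n+n≡m m≤v) (identity w m) ⟩
    m ² + v * v          ≈⟨ m+kv≈m (m ²) v ⟩
    m ²                  ∎
    where
    open ≈-Reasoning
    w = v ∸ m
    identity : ∀ w m → w * w + 2 * m * (w + m) ≡ m * m + (w + m) * (w + m)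
    identity = solve-∀

  v≡r+[v/12]*12 : ∀ {r} → v % 12 ≡ r → v ≡ r + v / 12 * 12
  v≡r+[v/12]*12 v%12≡r = trans (m≡m%n+[m/n]*n v 12) (cong (_+ v / 12 * 12) v%12≡r)

  squareSum≈2*[v/3] : v % 12 ≡ 3 → squareSum v ≈ 2 * (v / 3)
  squareSum≈2*[v/3] v%12≡3 = begin
    squareSum v                          ≡⟨ squareSum-3+12k k v≡3+12k ⟩
    2 * (1 + k * 4) + c * v              ≈⟨ m+kv≈m (2 * (1 + k * 4)) c ⟩
    2 * (1 + k * 4)                      ≡⟨ cong (2 *_) v/3≡1+4k ⟨
    2 * (v / 3)                          ∎
    where
    open ≈-Reasoning
    k = v / 12
    c = 1 + 18 * k + 48 * k * k
    v≡3+12k : v ≡ 3 + k * 12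
    v≡3+12k = v≡r+[v/12]*12 v%12≡3
    identity : ∀ k → 3 + k * 12 ≡ (1 + k * 4) * 3
    identity = solve-∀
    v/3≡1+4k : v / 3 ≡ 1 + k * 4
    v/3≡1+4k = trans (cong (_/ 3) (trans v≡3+12k (identity k))) (m*n/n≡m (1 + k * 4) 3)

  squareSum≈0 : v % 12 ≡ 7 ⊎ v % 12 ≡ 11 → squareSum v ≈ 0
  squareSum≈0 (inj₁ v%12≡7) =
    trans (cong (_% v) (squareSum-7+12k k (v≡r+[v/12]*12 v%12≡7))) (m+kv≈m 0 ((1 + 2 * k) * (13 + 24 * k)))
    where k = v / 12
  squareSum≈0 (inj₂ v%12≡11) =
    trans (cong (_% v) (squareSum-11+12k k (v≡r+[v/12]*12 v%12≡11))) (m+kv≈m 0 ((5 + 6 * k) * (7 + 8 * k)))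
    where k = v / 12

module Residues (v : ℕ) .{{_ : NonZero v}} where
  open ZMod v
  open Congruence v

  toℕ-[] : ∀ m → toℕ [ m ] ≈ m
  toℕ-[] m = trans (cong (_% v) (toℕ-fromℕ< (m%n<n m v))) (m%n%n≡m%n m v)

  toℕ-≈⇒≡ : ∀ {x y : ZV} → toℕ x ≈ toℕ y → x ≡ y
  toℕ-≈⇒≡ {x} {y} x≈y = toℕ-injective (trans (sym (m<n⇒m%n≡m (toℕ<n x))) (trans x≈y (m<n⇒m%n≡m (toℕ<n y))))

  toℕ-*v : ∀ x y → toℕ (x *v y) ≈ toℕ x * toℕ y
  toℕ-*v x y = toℕ-[] (toℕ x * toℕ y)

  toℕ-neg : ∀ x → toℕ (-v x) ≈ v ∸ toℕ x
  toℕ-neg x = toℕ-[] (v ∸ toℕ x)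

  toℕ-sub : ∀ x y → toℕ (x -v y) ≈ toℕ x + (v ∸ toℕ y)
  toℕ-sub x y = trans (toℕ-[] (toℕ x + toℕ (-v y))) (+-cong {toℕ x} refl (toℕ-neg y))

  toℕ-sub-+ : ∀ x y → toℕ (x -v y) + toℕ y ≈ toℕ x
  toℕ-sub-+ x y = begin
    toℕ (x -v y) + b        ≈⟨ +-cong (toℕ-sub x y) refl ⟩
    a + (v ∸ b) + b         ≡⟨ +-assoc a (v ∸ b) b ⟩
    a + ((v ∸ b) + b)       ≡⟨ cong (a +_) (+-comm (v ∸ b) b) ⟩
    a + (b + (v ∸ b))       ≈⟨ +-cong {a} refl (m+[v∸m]≈0 (<⇒≤ (toℕ<n y))) ⟩
    a + 0                   ≡⟨ +-identityʳ a ⟩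
    a                       ∎
    where
    open ≈-Reasoning
    a = toℕ x
    b = toℕ y

  neg-² : ∀ x → toℕ (-v x) ² ≈ toℕ x ²
  neg-² x = trans (*-cong (toℕ-neg x) (toℕ-neg x)) ([v∸m]²≈m² (<⇒≤ (toℕ<n x)))

  parallelogram : ∀ x y → toℕ (x -v y) ² + toℕ (x +v y) ² ≈ 2 * (toℕ x ² + toℕ y ²)
  parallelogram x y = begin
    toℕ (x -v y) ² + toℕ (x +v y) ²             ≈⟨ +-cong (*-cong x-y≈a+w x-y≈a+w) (*-cong x+y≈a+b x+y≈a+b) ⟩
    (a + w) ² + (a + b) ²                       ≡⟨ expand a w b ⟩
    2 * a ² + w ² + b ² + 2 * a * (b + w)       ≈⟨ +-cong (+-cong (+-cong {2 * a ²} refl w²≈b²) refl)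
                                                          (*-cong {2 * a} refl (m+[v∸m]≈0 (<⇒≤ (toℕ<n y)))) ⟩
    2 * a ² + b ² + b ² + 2 * a * 0             ≡⟨ collect a b ⟩
    2 * (a ² + b ²)                             ∎
    where
    open ≈-Reasoning
    a = toℕ x
    b = toℕ y
    w = v ∸ b
    x-y≈a+w : toℕ (x -v y) ≈ a + w
    x-y≈a+w = toℕ-sub x y
    x+y≈a+b : toℕ (x +v y) ≈ a + b
    x+y≈a+b = toℕ-[] (a + b)
    w²≈b² : w ² ≈ b ²
    w²≈b² = [v∸m]²≈m² (<⇒≤ (toℕ<n y))
    expand : ∀ a w b → (a + w) * (a + w) + (a + b) * (a + b) ≡ 2 * (a * a) + w * w + b * b + 2 * a * (b + w)
    expand = solve-∀
    collect : ∀ a b → 2 * (a * a) + b * b + b * b + 2 * a * 0 ≡ 2 * (a * a + b * b)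
    collect = solve-∀

  ±_ : ZV × ZV → List ZV
  ± (x , y) = x ∷ -v x ∷ y ∷ -v y ∷ []

  sumDiff : ZV × ZV → ZV × ZV
  sumDiff (x , y) = x -v y , x +v y

  pairSq : ZV × ZV → ℕ
  pairSq (x , y) = toℕ x ² + toℕ y ²

  sumSq : List ZV → ℕ
  sumSq zs = sum (map (_² ∘ toℕ) zs)

  sumSq-++ : ∀ xs ys → sumSq (xs ++ ys) ≡ sumSq xs + sumSq ys
  sumSq-++ xs ys = trans (cong sum (map-++ (_² ∘ toℕ) xs ys)) (sum-++ (map (_² ∘ toℕ) xs) _)

  ∈-± : ∀ {z p} → InPM z p → z ∈ ± p
  ∈-± (inj₁ z≡x) = here z≡x
  ∈-± (inj₂ (inj₁ z≡-x)) = there (here z≡-x)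
  ∈-± (inj₂ (inj₂ (inj₁ z≡y))) = there (there (here z≡y))
  ∈-± (inj₂ (inj₂ (inj₂ z≡-y))) = there (there (there (here z≡-y)))

  ∈-concatMap-± : ∀ {z} S → Any (InPM z) S → z ∈ concatMap ±_ S
  ∈-concatMap-± S = ∈-concatMap⁺ ±_ ∘ Any.map ∈-±

  length-concatMap-± : ∀ S → length (concatMap ±_ S) ≡ length S * 4
  length-concatMap-± [] = refl
  length-concatMap-± (_ ∷ S) = cong (suc ∘ suc ∘ suc ∘ suc) (length-concatMap-± S)

  sumSq-concatMap-± : ∀ S → sumSq (concatMap ±_ S) ≈ 2 * sum (map pairSq S)
  sumSq-concatMap-± [] = refl
  sumSq-concatMap-± ((x , y) ∷ S) = begin
    a + (toℕ (-v x) ² + (b + (toℕ (-v y) ² + sumSq (concatMap ±_ S))))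
      ≈⟨ +-cong {a} refl (+-cong (neg-² x) (+-cong {b} refl (+-cong (neg-² y) (sumSq-concatMap-± S)))) ⟩
    a + (a + (b + (b + 2 * A)))
      ≡⟨ identity a b A ⟩
    2 * (a + b + A) ∎
    where
    open ≈-Reasoning
    a = toℕ x ²
    b = toℕ y ²
    A = sum (map pairSq S)
    identity : ∀ a b c → a + (a + (b + (b + 2 * c))) ≡ 2 * (a + b + c)
    identity = solve-∀

  sum-pairSq-sumDiff : ∀ S → sum (map pairSq (map sumDiff S)) ≈ 2 * sum (map pairSq S)
  sum-pairSq-sumDiff [] = refl
  sum-pairSq-sumDiff ((x , y) ∷ S) =
    trans (+-cong (parallelogram x y) (sum-pairSq-sumDiff S))
          (cong (_% v) (sym (*-distribˡ-+ 2 (pairSq (x , y)) (sum (map pairSq S)))))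

  squareSum≈sumSq+2γ² : ∀ (zs : List ZV) γ → length zs + 3 ≡ v →
    (∀ z → ¬ (z ≡ 0v ⊎ z ≡ γ ⊎ z ≡ -v γ) → z ∈ zs) →
    squareSum v ≈ sumSq zs + 2 * toℕ γ ²
  squareSum≈sumSq+2γ² zs γ |zs|+3≡v covers = begin
    squareSum v                 ≡⟨ cong sum (map-∘toℕ-allFin v _²) ⟨
    sumSq (allFin v)            ≡⟨ sum-↭ (↭.map⁺ (_² ∘ toℕ) zs++γs↭allFin) ⟨
    sumSq (zs ++ γs)            ≡⟨ sumSq-++ zs γs ⟩
    sumSq zs + sumSq γs         ≈⟨ +-cong {sumSq zs} refl sumSq-γs ⟩
    sumSq zs + 2 * toℕ γ ²      ∎
    where
    open ≈-Reasoning
    γs = 0v ∷ γ ∷ -v γ ∷ []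
    allFin⊆zs++γs : allFin v ⊆ zs ++ γs
    allFin⊆zs++γs {z} _ with z ≟ 0v ⊎-dec z ≟ γ ⊎-dec z ≟ -v γ
    ... | yes (inj₁ z≡0) = ∈-++⁺ʳ zs (here z≡0)
    ... | yes (inj₂ (inj₁ z≡γ)) = ∈-++⁺ʳ zs (there (here z≡γ))
    ... | yes (inj₂ (inj₂ z≡-γ)) = ∈-++⁺ʳ zs (there (there (here z≡-γ)))
    ... | no z∉γs = ∈-++⁺ˡ (covers z z∉γs)
    zs++γs↭allFin : zs ++ γs ↭ allFin v
    zs++γs↭allFin = ⊆∧length≤⇒↭ (allFin⁺ v) allFin⊆zs++γs
      (≤-reflexive (trans (length-++ zs) (trans |zs|+3≡v (sym (length-tabulate id)))))
    sumSq-γs : sumSq γs ≈ 2 * toℕ γ ²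
    sumSq-γs = +-cong (*-cong (toℕ-[] 0) (toℕ-[] 0)) (+-cong {toℕ γ ²} refl (+-cong (neg-² γ) refl))

  squareSum≈2A+2α² : ∀ {α} S → length S * 4 + 3 ≡ v →
    (∀ z → ¬ (z ≡ 0v ⊎ z ≡ α ⊎ z ≡ -v α) → Any (InPM z) S) →
    squareSum v ≈ 2 * sum (map pairSq S) + 2 * toℕ α ²
  squareSum≈2A+2α² {α} S 4|S|+3≡v covers = trans
    (squareSum≈sumSq+2γ² (concatMap ±_ S) α (trans (cong (_+ 3) (length-concatMap-± S)) 4|S|+3≡v)
      (λ z z∉ → ∈-concatMap-± S (covers z z∉)))
    (+-cong (sumSq-concatMap-± S) refl)

  squareSum≈4A+2β² : ∀ {β} S → length S * 4 + 3 ≡ v →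
    (∀ z → ¬ (z ≡ 0v ⊎ z ≡ β ⊎ z ≡ -v β) → Any (InPMDiffSum z) S) →
    squareSum v ≈ 2 * (2 * sum (map pairSq S)) + 2 * toℕ β ²
  squareSum≈4A+2β² {β} S 4|S|+3≡v covers = trans
    (squareSum≈2A+2α² (map sumDiff S) (trans (cong (λ n → n * 4 + 3) (length-map sumDiff S)) 4|S|+3≡v)
      (λ z z∉ → Any.map⁺ (covers z z∉)))
    (+-cong (*-cong {2} refl (sum-pairSq-sumDiff S)) refl)

  2α²-β²+β²≈2α² : ∀ α β → toℕ (([ 2 ] *v (α *v α)) -v (β *v β)) + toℕ β ² ≈ 2 * toℕ α ²
  2α²-β²+β²≈2α² α β = begin
    toℕ (X -v β²) + toℕ β ²      ≈⟨ +-cong {toℕ (X -v β²)} refl (toℕ-*v β β) ⟨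
    toℕ (X -v β²) + toℕ β²       ≈⟨ toℕ-sub-+ X β² ⟩
    toℕ X                        ≈⟨ toℕ-*v [ 2 ] (α *v α) ⟩
    toℕ [ 2 ] * toℕ (α *v α)     ≈⟨ *-cong (toℕ-[] 2) (toℕ-*v α α) ⟩
    2 * toℕ α ²                  ∎
    where
    open ≈-Reasoning
    X = [ 2 ] *v (α *v α)
    β² = β *v β

  2[2α²-β²]≈squareSum : v % 4 ≡ 3 → ∀ {α β S} → IsAPS α β S →
    2 * toℕ (([ 2 ] *v (α *v α)) -v (β *v β)) ≈ squareSum v
  2[2α²-β²]≈squareSum v%4≡3 {α} {β} {S} aps = +-cancelʳ (2 * b) (begin
    2 * e + 2 * b          ≡⟨ *-distribˡ-+ 2 e b ⟨
    2 * (e + b)            ≈⟨ *-cong {2} refl (2α²-β²+β²≈2α² α β) ⟩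
    2 * (2 * a)            ≈⟨ +-cancelʳ Σ 4a+Σ≈Σ+2b+Σ ⟩
    Σ + 2 * b              ∎)
    where
    open ≈-Reasoning
    open IsAPS aps
    e = toℕ (([ 2 ] *v (α *v α)) -v (β *v β))
    a = toℕ α ²
    b = toℕ β ²
    A = sum (map pairSq S)
    Σ = squareSum v
    4|S|+3≡v : length S * 4 + 3 ≡ v
    4|S|+3≡v = trans (cong (λ n → n * 4 + 3) size) ([n∸3]/4*4+3≡n v%4≡3)
    regroup : ∀ a A b → 2 * (2 * a) + (2 * (2 * A) + 2 * b) ≡ 2 * (2 * A + 2 * a) + 2 * b
    regroup = solve-∀
    rotate : ∀ s b → 2 * s + 2 * b ≡ s + 2 * b + s
    rotate = solve-∀
    4a+Σ≈Σ+2b+Σ : 2 * (2 * a) + Σ ≈ Σ + 2 * b + Σ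
    4a+Σ≈Σ+2b+Σ = begin
      2 * (2 * a) + Σ                        ≈⟨ +-cong {2 * (2 * a)} refl (squareSum≈4A+2β² S 4|S|+3≡v cover₂') ⟩
      2 * (2 * a) + (2 * (2 * A) + 2 * b)    ≡⟨ regroup a A b ⟩
      2 * (2 * A + 2 * a) + 2 * b            ≈⟨ +-cong (*-cong {2} refl (squareSum≈2A+2α² S 4|S|+3≡v cover₁')) refl ⟨
      2 * Σ + 2 * b                          ≡⟨ rotate Σ b ⟩
      Σ + 2 * b + Σ                          ∎

lemma3p1 : (v : ℕ) .{{_ : NonZero v}} → v % 4 ≡ 3 →
  (α β : Fin v) → α ≢ ZMod.0v v → β ≢ ZMod.0v v →
  ∃ (λ (S : List (Fin v × Fin v)) → ZMod.IsAPS v α β S) →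
  let open ZMod v in
  let e = ([ 2 ] *v (α *v α)) -v (β *v β) in
  (v % 12 ≡ 3 → e ≡ [ v / 3 ]) × (v % 12 ≡ 7 ⊎ v % 12 ≡ 11 → e ≡ 0v)
lemma3p1 v v%4≡3 α β _ _ (S , aps) = case-3 , case-7∨11
  where
  open ZMod v
  open Congruence v
  open Residues v
  e : ZV
  e = ([ 2 ] *v (α *v α)) -v (β *v β)
  halve : ∀ {m n} → 2 * m ≈ 2 * n → m ≈ n
  halve = *-cancelˡ-2 (trans (sym (m∣n⇒o%n%m≡o%m 2 4 v (divides 2 refl))) (cong (_% 2) v%4≡3))
  2e≈Σ : 2 * toℕ e ≈ squareSum v
  2e≈Σ = 2[2α²-β²]≈squareSum v%4≡3 aps
  case-3 : v % 12 ≡ 3 → e ≡ [ v / 3 ]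
  case-3 h = toℕ-≈⇒≡ (halve (trans 2e≈Σ (trans (squareSum≈2*[v/3] h) (sym (*-cong {2} refl (toℕ-[] (v / 3)))))))
  case-7∨11 : v % 12 ≡ 7 ⊎ v % 12 ≡ 11 → e ≡ 0v
  case-7∨11 h = toℕ-≈⇒≡ (halve (trans 2e≈Σ (trans (squareSum≈0 h) (sym (*-cong {2} refl (toℕ-[] 0))))))
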